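{- Let $\mathcal{M}=\langle S,\to,L\rangle$ be a labeled transition system, let $B\subseteq S\times S$ be a skipping simulation on $\mathcal{M}$, and let $s,w\in S$. Then every path (from the root) of the tree $\mathit{ranktCt}(\mathcal{M},s,w)$ is finite.
   Context: A labeled transition system $\mathcal{M}=\langle S,\to,L\rangle$ consists of a non-empty set $S$, a left-total relation $\to\ \subseteq S\times S$, and a labeling function $L$ with domain $S$. A fullpath is an infinite sequence $\sigma(0),\sigma(1),\dots$ with $\sigma(i)\to\sigma(i+1)$ for all $i$, starting at $\sigma(0)$. $w\to^{+}v$ means $v$ is reachable from $w$ in finitely many, at least one, steps. Let INC be the set of strictly increasing $\pi:\omega\to\omega$ with $\pi(0)=0$. For fullpaths $\sigma,\delta$, $\mathit{match}(B,\sigma,\delta)$ holds iff there are $\pi,\xi\in$ INC such that for every $i\in\omega$ and every $j$ with $\pi(i)\le j<\pi(i+1)$, $\sigma(j)\,B\,\delta(\xi(i))$. $B$ is a skipping simulation (SKS) on $\mathcal{M}$ iff for all $s,w$ with $sBw$: $L(s)=L(w)$, and for every fullpath $\sigma$ starting at $s$ there is a fullpath $\delta$ starting at $w$ with $\mathit{match}(B,\sigma,\delta)$. The computation tree $\mathit{ctree}(\mathcal{M},s)$ is the smallest tree whose nodes are finite sequences over $S$ such that $\langle s\rangle$ is the root, and if $\langle s,\dots,x\rangle$ is a node and $x\to y$ then $\langle s,\dots,x,y\rangle$ is a node whose parent is $\langle s,\dots,x\rangle$. Given the SKS $B$: if not $sBw$, $\mathit{ranktCt}(\mathcal{M},s,w)$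 is the empty tree; otherwise it is the largest subtree of $\mathit{ctree}(\mathcal{M},s)$ (containing the root and closed under taking parents) such that for every non-root node $\langle s,\dots,x\rangle$ of it, $xBw$ and there is no $v$ with $w\to^{+}v$ and $xBv$. -}

module Defs where

open import Data.Nat using (ℕ; zero; suc; _≤_; _<_)
open import Data.List using (List; []; _∷_; [_]; _∷ʳ_)
open import Data.Product using (Σ; ∃; ∃-syntax; _×_; _,_)
open import Relation.Nullary using (¬_)
open import Relation.Binary.PropositionalEquality using (_≡_)

record LTS : Set₁ where
  field
    S      : Set
    _⟶_    : S → S → Set
    total  : ∀ x → ∃[ y ] (x ⟶ y)
    Label  : Set
    L      : S → Label

module _ (M : LTS) where
  open LTS M

  data _⟶⁺_ : S → S → Set where
    one  : ∀ {x y} → x ⟶ y → x ⟶⁺ y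
    more : ∀ {x y z} → x ⟶ y → y ⟶⁺ z → x ⟶⁺ z

  IsFullpath : (ℕ → S) → Set
  IsFullpath σ = ∀ i → σ i ⟶ σ (suc i)

  INC : (ℕ → ℕ) → Set
  INC π = (π 0 ≡ 0) × (∀ i → π i < π (suc i))

  match : (S → S → Set) → (ℕ → S) → (ℕ → S) → Set
  match B σ δ = Σ (ℕ → ℕ) λ π → Σ (ℕ → ℕ) λ ξ → INC π × INC ξ ×
    (∀ i j → π i ≤ j → j < π (suc i) → B (σ j) (δ (ξ i)))

  IsSKS : (S → S → Set) → Set
  IsSKS B = ∀ s w → B s w →
    (L s ≡ L w) ×
    (∀ σ → IsFullpath σ → σ 0 ≡ s →
       Σ (ℕ → S) λ δ → IsFullpath δ × (δ 0 ≡ w) × match B σ δ)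

  -- Nodes of ctree(M,s): finite sequences ⟨s,…,x⟩ (as lists, root [ s ]);
  -- CTNode s ns x : ns is a node whose last element is x.
  data CTNode (s : S) : List S → S → Set where
    root  : CTNode s [ s ] s
    child : ∀ {ns x y} → CTNode s ns x → x ⟶ y → CTNode s (ns ∷ʳ y) y

  -- Nodes of ranktCt(M,s,w) for the relation B: empty unless s B w; otherwise
  -- the largest parent-closed subtree of ctree(M,s) in which every non-root
  -- node ⟨s,…,x⟩ has x B w and no v with w →⁺ v and x B v.  (A node belongs
  -- to it iff it and all its ancestors satisfy the condition.)
  data RankNode (B : S → S → Set) (s w : S) : List S → S → Set where
    root  : B s w → RankNode B s w [ s ] s
    child : ∀ {ns x y} → RankNode B s w ns x → x ⟶ y →
            B y w → ¬ (∃[ v ] ((w ⟶⁺ v) × B y v)) →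
            RankNode B s w (ns ∷ʳ y) y

  InRanktCt : (B : S → S → Set) → S → S → List S → Set
  InRanktCt B s w ns = ∃[ x ] RankNode B s w ns x

  ChildOf : List S → List S → Set
  ChildOf ns' ns = ∃[ y ] (ns' ≡ ns ∷ʳ y)

  InfinitePath : (B : S → S → Set) → S → S → (ℕ → List S) → Set
  InfinitePath B s w p =
    (p 0 ≡ [ s ]) × (∀ i → InRanktCt B s w (p i)) × (∀ i → ChildOf (p (suc i)) (p i))

-- Along an infinite path of ranktCt(M,s,w) the last states form a fullpath σ from s,
-- and every σ k with k > 0 is B-related to no state strictly reachable from w.
-- Matching σ against a fullpath δ from w, as the skipping simulation allows, relates
-- the non-root state σ (π 1) to δ (ξ 1), which is strictly reachable from w.
module Submission where

open import Defs
open import Data.Product using (Σ; ∃-syntax; _×_; _,_; proj₁; proj₂)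
open import Data.Nat using (ℕ; zero; suc; _<_)
open import Data.Nat.Properties using (≤-refl)
open import Data.List using (List; []; [_]; _∷ʳ_)
open import Data.List.Properties using (∷ʳ-injective; ∷ʳ-injectiveˡ; ∷ʳ-injectiveʳ; ++-conicalʳ)
open import Relation.Nullary using (¬_)
open import Relation.Binary.PropositionalEquality using (_≡_; refl; sym; subst)

module _ (M : LTS) where
  open LTS M

  fullpath-reaches : ∀ {δ k} → IsFullpath M δ → 0 < k → _⟶⁺_ M (δ 0) (δ k)
  fullpath-reaches {k = suc k} δ-fp _ = reaches-suc δ-fp k
    where
    reaches-suc : ∀ {δ} → IsFullpath M δ → ∀ k → _⟶⁺_ M (δ 0) (δ (suc k))
    reaches-suc δ-fp zero    = one (δ-fp 0)
    reaches-suc δ-fp (suc k) = more (δ-fp 0) (reaches-suc (λ i → δ-fp (suc i)) k)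

  INC⇒0<f1 : ∀ {f} → INC M f → 0 < f 1
  INC⇒0<f1 {f} (f0≡0 , f-inc) = subst (_< f 1) f0≡0 (f-inc 0)

  RelatedBeyond : (S → S → Set) → S → S → Set
  RelatedBeyond B w x = ∃[ v ] (_⟶⁺_ M w v × B x v)

module _ {M : LTS} {B : LTS.S M → LTS.S M → Set} {s w : LTS.S M} where
  open LTS M

  RankNode-last : ∀ {ns x} → RankNode M B s w ns x → Σ (List S) λ ms → ns ≡ ms ∷ʳ x
  RankNode-last (root _)                  = [] , refl
  RankNode-last (child {ns = ns} _ _ _ _) = ns , refl

  RankNode-functional : ∀ {ns x y} → RankNode M B s w ns x → RankNode M B s w ns y → x ≡ y
  RankNode-functional r r′ with RankNode-last r | RankNode-last r′
  ... | ms , refl | ms′ , eq = ∷ʳ-injectiveʳ ms ms′ eq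

  RankNode⇒related : ∀ {ns x} → RankNode M B s w ns x → B s w
  RankNode⇒related (root sBw)     = sBw
  RankNode⇒related (child r _ _ _) = RankNode⇒related r

  RankNode-step : ∀ {ns x ns′ y} → RankNode M B s w ns x → RankNode M B s w ns′ y →
                  ChildOf M ns′ ns → (x ⟶ y) × ¬ RelatedBeyond M B w y
  -- The root is nobody's child: [ s ] ≡ (ms ∷ʳ x) ∷ʳ z would force [] ≡ ms ∷ʳ x.
  RankNode-step r (root _) (_ , eq) with RankNode-last r
  ... | ms , refl with () ← ++-conicalʳ ms [ _ ] (sym (∷ʳ-injectiveˡ [] (ms ∷ʳ _) eq))
  RankNode-step r (child {ns = ns₀} r₀ x₀⟶y _ isolated) (_ , eq)
    with refl , refl ← ∷ʳ-injective ns₀ _ eq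
    with refl ← RankNode-functional r₀ r
    = x₀⟶y , isolated

module InfinitePathStates (M : LTS) (B : LTS.S M → LTS.S M → Set) {s w : LTS.S M}
                          {p : ℕ → List (LTS.S M)} (path : InfinitePath M B s w p) where
  open LTS M

  private
    p0≡[s] = proj₁ path
    nodes  = proj₁ (proj₂ path)
    steps  = proj₂ (proj₂ path)

  state : ℕ → S
  state i = proj₁ (nodes i)

  node : ∀ i → RankNode M B s w (p i) (state i)
  node i = proj₂ (nodes i)

  root-related : B s w
  root-related = RankNode⇒related (node 0)

  state-fullpath : IsFullpath M state
  state-fullpath i = proj₁ (RankNode-step (node i) (node (suc i)) (steps i))

  state-start : state 0 ≡ s
  state-start = RankNode-functional (node 0)
    (subst (λ ns → RankNode M B s w ns s) (sym p0≡[s]) (root root-related))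

  state-isolated : ∀ {k} → 0 < k → ¬ RelatedBeyond M B w (state k)
  state-isolated {suc i} _ = proj₂ (RankNode-step (node i) (node (suc i)) (steps i))

lemma1 : (M : LTS) → (B : LTS.S M → LTS.S M → Set) → IsSKS M B →
    (s w : LTS.S M) → ¬ (Σ (ℕ → List (LTS.S M)) λ p → InfinitePath M B s w p)
lemma1 M B sks s w (_ , path) = refute (proj₂ (sks s w root-related) state state-fullpath state-start)
  where
  open InfinitePathStates M B path
  refute : ¬ (Σ (ℕ → LTS.S M) λ δ → IsFullpath M δ × δ 0 ≡ w × match M B state δ)
  refute (δ , δ-fp , δ0≡w , π , ξ , π-inc , ξ-inc , matched) =
    state-isolated (INC⇒0<f1 M π-inc)
      (δ (ξ 1) , subst (λ u → _⟶⁺_ M u (δ (ξ 1))) δ0≡w (fullpath-reaches M δ-fp (INC⇒0<f1 M ξ-inc))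
               , matched 1 (π 1) ≤-refl (proj₂ π-inc 1))
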